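{- Let $\mathcal{H}$ be a shortest path graph and let $\mathcal{K}$ be a maximal clique in $\mathcal{H}$. Then each vertex in $V(\mathcal{H})\setminus V(\mathcal{K})$ is adjacent to at most one vertex of $\mathcal{K}$.
   Context: For a simple graph $G$ and distinct $a,b\in V(G)$, the shortest path graph $S(G,a,b)$ has as vertices the shortest $a$–$b$ paths in $G$, two being adjacent iff their vertex sets differ in exactly one vertex. A shortest path graph is any graph isomorphic to some $S(G,a,b)$. A maximal clique is a clique $\mathcal{K}$ such that no vertex outside $\mathcal{K}$ is adjacent to all vertices of $\mathcal{K}$. -}

module Defs where

open import Level using (Level; _⊔_) renaming (suc to lsuc)
open import Data.Nat using (ℕ; _≤_)
open import Data.Fin using (Fin)
open import Data.List using (List; []; _∷_; length)
open import Data.List.Membership.Propositional using (_∈_; _∉_)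
open import Data.List.Relation.Unary.Unique.Propositional using (Unique)
open import Data.Product using (Σ; ∃; _×_)
open import Data.Empty using (⊥)
open import Relation.Nullary using (¬_)
open import Relation.Binary.PropositionalEquality using (_≡_; _≢_)
open import Function.Bundles using (_↔_; Inverse)

record SimpleGraph (n : ℕ) : Set₁ where
  field
    Adj     : Fin n → Fin n → Set
    symm    : ∀ {x y} → Adj x y → Adj y x
    irrefl  : ∀ {x} → ¬ Adj x x

record Graph : Set₁ where
  field
    Vertex : Set
    Adj    : Vertex → Vertex → Set

module _ {n : ℕ} (G : SimpleGraph n) where
  open SimpleGraph G

  IsWalk : Fin n → Fin n → List (Fin n) → Set
  IsWalk a b []           = ⊥
  IsWalk a b (x ∷ [])     = a ≡ x × x ≡ b
  IsWalk a b (x ∷ y ∷ xs) = a ≡ x × Adj x y × IsWalk y b (y ∷ xs)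

  IsPath : Fin n → Fin n → List (Fin n) → Set
  IsPath a b vs = IsWalk a b vs × Unique vs

  IsShortestPath : Fin n → Fin n → List (Fin n) → Set
  IsShortestPath a b vs =
    IsPath a b vs × (∀ ws → IsPath a b ws → length vs ≤ length ws)

  -- vertices of S(G,a,b): shortest a–b paths (the proof is irrelevant, so
  -- two vertices are equal iff the underlying vertex sequences are equal)
  record ShortestPath (a b : Fin n) : Set where
    constructor mkSP
    field
      path : List (Fin n)
      .isShortest : IsShortestPath a b path

  open ShortestPath

  -- V(P) and V(Q) differ in exactly one vertex:
  -- exactly one vertex of P is not on Q, and exactly one vertex of Q is not on P
  ExactlyOneOutside : List (Fin n) → List (Fin n) → Set
  ExactlyOneOutside P Q = ∃ λ x → x ∈ P × x ∉ Q × (∀ z → z ∈ P → z ∉ Q → z ≡ x)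

  DifferInOneVertex : List (Fin n) → List (Fin n) → Set
  DifferInOneVertex P Q = ExactlyOneOutside P Q × ExactlyOneOutside Q P

  S : Fin n → Fin n → Graph
  S a b = record
    { Vertex = ShortestPath a b
    ; Adj    = λ P Q → DifferInOneVertex (path P) (path Q) }

record _≅_ (H K : Graph) : Set where
  field
    bij : Graph.Vertex H ↔ Graph.Vertex K
  open Inverse bij using (to)
  field
    preserves : ∀ x y → Graph.Adj H x y → Graph.Adj K (to x) (to y)
    reflects  : ∀ x y → Graph.Adj K (to x) (to y) → Graph.Adj H x y

IsShortestPathGraph : Graph → Set₁
IsShortestPathGraph H =
  Σ ℕ λ n → Σ (SimpleGraph n) λ G → Σ (Fin n) λ a → Σ (Fin n) λ b →
    a ≢ b × (H ≅ S G a b)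

module _ (H : Graph) where
  open Graph H

  IsClique : (Vertex → Set) → Set
  IsClique K = ∀ x y → K x → K y → x ≢ y → Adj x y

  IsMaximalClique : (Vertex → Set) → Set
  IsMaximalClique K =
    IsClique K × (∀ v → ¬ K v → ¬ (∀ x → K x → Adj v x))

module Submission where

-- On a shortest a–b path the vertex in position i lies at
-- distance i from a, so a vertex shared by two shortest paths occupies the
-- same position on both.  Hence two shortest paths differ in exactly one
-- vertex iff, as sequences, they differ in exactly one position.  If X, Y
-- are adjacent in S(G,a,b) and differ in position i, then every common
-- neighbour of X and Y differs from X in position i too, so any two distinct
-- common neighbours V, Z of the edge XY differ from each other only in
-- position i and are adjacent: the common neighbours of an edge are
-- pairwise adjacent.  This property (and decidable equality of vertices)
-- is invariant under isomorphism, and in any graph with it a vertex v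
-- outside a maximal clique K adjacent to two distinct x, y ∈ K would be
-- adjacent to all of K, contradicting maximality.

open import Defs
open import Relation.Nullary using (¬_)
open import Relation.Binary.PropositionalEquality using (_≡_)

open import Data.Nat using (ℕ; zero; suc; _≤_; _<_; s≤s)
import Data.Nat.Properties as ℕₚ
open import Data.Fin using (Fin)
import Data.Fin.Properties as Finₚ
open import Data.List using (List; []; _∷_; length; _++_)
import Data.List.Properties as Listₚ
open import Data.List.Membership.Propositional using (_∈_; _∉_)
import Data.List.Membership.DecPropositional as DecMembership
open import Data.List.Relation.Unary.Any using (here; there)
import Data.List.Relation.Unary.All as All
open import Data.List.Relation.Unary.All using ([])
open import Data.List.Relation.Unary.All.Properties using (¬Any⇒All¬)
open import Data.List.Relation.Unary.Unique.Propositional using (Unique)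
open import Data.List.Relation.Unary.AllPairs using ([]; _∷_)
open import Data.Maybe using (Maybe; just; nothing)
import Data.Maybe.Properties as Maybeₚ
open import Data.Product using (∃; _×_; _,_; proj₁; proj₂)
open import Data.Empty using (⊥-elim)
open import Relation.Nullary using (yes; no)
open import Relation.Nullary.Decidable using (recompute; decidable-stable; map′; via-injection)
open import Relation.Binary.Definitions using (DecidableEquality; tri<; tri≈; tri>)
open import Relation.Binary.PropositionalEquality using (_≢_; refl; sym; trans; cong; cong₂; subst; subst₂)
open import Function.Bundles using (Inverse; Injection)
open import Function.Properties.Inverse using (↔⇒↣)

module _ {A : Set} where

  at : List A → ℕ → Maybe A
  at []       _       = nothing
  at (x ∷ xs) zero    = just x
  at (x ∷ xs) (suc i) = at xs i

  at-∈ : ∀ {xs : List A} {u} → u ∈ xs → ∃ λ i → at xs i ≡ just u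
  at-∈ (here refl) = zero , refl
  at-∈ (there u∈xs) with at-∈ u∈xs
  ... | i , eq = suc i , eq

  ∈-at : ∀ (xs : List A) i {u} → at xs i ≡ just u → u ∈ xs
  ∈-at (x ∷ xs) zero    refl = here refl
  ∈-at (x ∷ xs) (suc i) eq   = there (∈-at xs i eq)

  at-unique : ∀ (xs : List A) i k {u} → Unique xs →
    at xs i ≡ just u → at xs k ≡ just u → i ≡ k
  at-unique (x ∷ xs) zero    zero    _        _    _    = refl
  at-unique (x ∷ xs) zero    (suc k) (x∉ ∷ _) refl eq   = ⊥-elim (All.lookup x∉ (∈-at xs k eq) refl)
  at-unique (x ∷ xs) (suc i) zero    (x∉ ∷ _) eq   refl = ⊥-elim (All.lookup x∉ (∈-at xs i eq) refl)
  at-unique (x ∷ xs) (suc i) (suc k) (_ ∷ u)  eq   eq′  = cong suc (at-unique xs i k u eq eq′)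

  at-nothing : ∀ (xs ys : List A) i → length xs ≡ length ys →
    at xs i ≡ nothing → at ys i ≡ nothing
  at-nothing []       []       i       _   _  = refl
  at-nothing (x ∷ xs) (y ∷ ys) (suc i) len eq = at-nothing xs ys i (ℕₚ.suc-injective len) eq

  at-ext : ∀ (xs ys : List A) → (∀ k → at xs k ≡ at ys k) → xs ≡ ys
  at-ext []       []       _     = refl
  at-ext []       (y ∷ ys) agree with agree zero
  ... | ()
  at-ext (x ∷ xs) []       agree with agree zero
  ... | ()
  at-ext (x ∷ xs) (y ∷ ys) agree =
    cong₂ _∷_ (Maybeₚ.just-injective (agree zero)) (at-ext xs ys (λ k → agree (suc k)))

  at-split : ∀ (xs : List A) i {u} → at xs i ≡ just u →
    ∃ λ pre → ∃ λ post → xs ≡ pre ++ u ∷ post × length pre ≡ i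
  at-split (x ∷ xs) zero    refl = [] , xs , refl , refl
  at-split (x ∷ xs) (suc i) eq with at-split xs i eq
  ... | pre , post , split , len = x ∷ pre , post , cong (x ∷_) split , cong suc len

module _ {A : Set} where

  DifferAt : List A → List A → ℕ → Set
  DifferAt P Q i = at P i ≢ at Q i × (∀ k → k ≢ i → at P k ≡ at Q k)

  DifferAt-sym : ∀ {P Q : List A} {i} → DifferAt P Q i → DifferAt Q P i
  DifferAt-sym (differ , agree) = (λ eq → differ (sym eq)) , λ k k≢i → sym (agree k k≢i)

  DifferAt-common : ∀ {X Y V : List A} {i j k} →
    DifferAt X Y i → DifferAt V X j → DifferAt V Y k → j ≡ i
  DifferAt-common {i = i} {j} {k} (X≠Y , X=Y) (V≠X , V=X) (V≠Y , V=Y) =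
    decidable-stable (j ℕₚ.≟ i) λ j≢i →
      let i≡k : i ≡ k
          i≡k = decidable-stable (i ℕₚ.≟ k) λ i≢k →
                  X≠Y (trans (sym (V=X i (λ i≡j → j≢i (sym i≡j)))) (V=Y i i≢k))
          j≢k : j ≢ k
          j≢k j≡k = j≢i (trans j≡k (sym i≡k))
      in V≠X (trans (V=Y j j≢k) (sym (X=Y j j≢i)))

  DifferAt-merge : ∀ {V X Z : List A} {i} → V ≢ Z →
    DifferAt V X i → DifferAt Z X i → DifferAt V Z i
  DifferAt-merge {V} {X} {Z} {i} V≢Z (_ , V=X) (_ , Z=X) =
    (λ eqᵢ → V≢Z (at-ext V Z (agree eqᵢ))) , λ k k≢i → trans (V=X k k≢i) (sym (Z=X k k≢i))
    where
    agree : at V i ≡ at Z i → ∀ k → at V k ≡ at Z k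
    agree eqᵢ k with k ℕₚ.≟ i
    ... | yes refl = eqᵢ
    ... | no k≢i   = trans (V=X k k≢i) (sym (Z=X k k≢i))

module Walks {n : ℕ} (G : SimpleGraph n) where
  open SimpleGraph G
  open DecMembership (Finₚ._≟_ {n}) using (_∈?_)

  Walk : Fin n → Fin n → List (Fin n) → Set
  Walk = IsWalk G

  walk-head : ∀ {c b w} rest → Walk c b (w ∷ rest) → c ≡ w
  walk-head []      (c≡w , _) = c≡w
  walk-head (_ ∷ _) (c≡w , _) = c≡w

  walk-rebase : ∀ {c b w} rest → Walk c b (w ∷ rest) → Walk w b (w ∷ rest)
  walk-rebase []      (_ , w≡b)     = refl , w≡b
  walk-rebase (_ ∷ _) (_ , adj , wk) = refl , adj , wk

  walk-cons : ∀ {c b x y} ws → c ≡ x → Adj x y → Walk y b ws → Walk c b (x ∷ ws)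
  walk-cons (w ∷ rest) c≡x adj wk =
    c≡x , subst (Adj _) (walk-head rest wk) adj , walk-rebase rest wk

  walk-split : ∀ {c b u} xs ys → Walk c b (xs ++ u ∷ ys) →
    Walk c u (xs ++ u ∷ []) × Walk u b (u ∷ ys)
  walk-split []           ys wk = (walk-head ys wk , refl) , walk-rebase ys wk
  walk-split (x ∷ [])     ys (c≡x , adj , wk) = (c≡x , adj , refl , refl) , wk
  walk-split (x ∷ x′ ∷ xs) ys (c≡x , adj , wk) with walk-split (x′ ∷ xs) ys wk
  ... | before , after = (c≡x , adj , before) , after

  walk-join : ∀ {c b u} xs ys → Walk c u (xs ++ u ∷ []) → Walk u b (u ∷ ys) →
    Walk c b (xs ++ u ∷ ys)
  walk-join []           ys (refl , _)       after = after
  walk-join (x ∷ [])     ys (c≡x , adj , _)  after = c≡x , adj , after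
  walk-join (x ∷ x′ ∷ xs) ys (c≡x , adj , wk) after = c≡x , adj , walk-join (x′ ∷ xs) ys wk after

  path-from : ∀ {c b x} ws → Walk c b ws → Unique ws → x ∈ ws →
    ∃ λ qs → Walk x b qs × Unique qs × length qs ≤ length ws
  path-from (w ∷ rest)     wk            uniq       (here refl) = w ∷ rest , walk-rebase rest wk , uniq , ℕₚ.≤-refl
  path-from (w ∷ y ∷ rest) (_ , _ , wk) (_ ∷ uniq) (there x∈)  with path-from (y ∷ rest) wk uniq x∈
  ... | qs , qw , qu , len = qs , qw , qu , ℕₚ.m≤n⇒m≤1+n len

  walk⇒path : ∀ {c b} ws → Walk c b ws →
    ∃ λ ps → Walk c b ps × Unique ps × length ps ≤ length ws
  walk⇒path (x ∷ [])     wk = x ∷ [] , wk , [] ∷ [] , ℕₚ.≤-refl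
  walk⇒path {c} {b} (x ∷ y ∷ xs) (c≡x , adj , wk) with walk⇒path (y ∷ xs) wk
  ... | ps , pw , pu , len with x ∈? ps
  ...   | no x∉ = x ∷ ps , walk-cons ps c≡x adj pw , ¬Any⇒All¬ ps x∉ ∷ pu , s≤s len
  ...   | yes x∈ with path-from ps pw pu x∈
  ...     | qs , qw , qu , len′ =
    qs , subst (λ c → Walk c b qs) (sym c≡x) qw , qu , ℕₚ.m≤n⇒m≤1+n (ℕₚ.≤-trans len′ len)

-- Shortest paths: vertices sit at their distance from the start

module ShortestPaths {n : ℕ} (G : SimpleGraph n) (a b : Fin n) where
  open Walks G
  open DecMembership (Finₚ._≟_ {n}) using (_∈?_)

  Shortest : List (Fin n) → Set
  Shortest = IsShortestPath G a b

  shortest-length : ∀ {P Q} → Shortest P → Shortest Q → length P ≡ length Q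
  shortest-length {P} {Q} sp sq = ℕₚ.≤-antisym (proj₂ sp Q (proj₁ sq)) (proj₂ sq P (proj₁ sp))

  -- if u came earlier on P than on Q, following P to u and then Q from u
  -- would give a walk, hence a path, shorter than Q
  no-earlier-occurrence : ∀ {u} p₁ p₂ q₁ q₂ →
    Shortest (p₁ ++ u ∷ p₂) → Shortest (q₁ ++ u ∷ q₂) → ¬ length p₁ < length q₁
  no-earlier-occurrence {u} p₁ p₂ q₁ q₂ sp sq p₁<q₁
    with walk-split p₁ p₂ (proj₁ (proj₁ sp)) | walk-split q₁ q₂ (proj₁ (proj₁ sq))
  ... | toU , _ | _ , fromU with walk⇒path (p₁ ++ u ∷ q₂) (walk-join p₁ q₂ toU fromU)
  ... | ps , pw , pu , ps≤ =
    ℕₚ.<-irrefl refl (ℕₚ.≤-<-trans (proj₂ sq ps (pw , pu)) (ℕₚ.≤-<-trans ps≤ spliced<Q))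
    where
    spliced<Q : length (p₁ ++ u ∷ q₂) < length (q₁ ++ u ∷ q₂)
    spliced<Q = subst₂ _<_ (sym (Listₚ.length-++ p₁)) (sym (Listₚ.length-++ q₁))
                  (ℕₚ.+-monoˡ-< (suc (length q₂)) p₁<q₁)

  same-position : ∀ {P Q} i j {u} → Shortest P → Shortest Q →
    at P i ≡ just u → at Q j ≡ just u → i ≡ j
  same-position {P} {Q} i j sp sq atP atQ with at-split P i atP | at-split Q j atQ
  ... | p₁ , p₂ , refl , refl | q₁ , q₂ , refl , refl with ℕₚ.<-cmp (length p₁) (length q₁)
  ... | tri< p₁<q₁ _ _ = ⊥-elim (no-earlier-occurrence p₁ p₂ q₁ q₂ sp sq p₁<q₁)
  ... | tri≈ _ eq _    = eq
  ... | tri> _ _ q₁<p₁ = ⊥-elim (no-earlier-occurrence q₁ q₂ p₁ p₂ sq sp q₁<p₁)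

  -- the same facts under irrelevant shortestness proofs, as carried by the
  -- vertices of S(G,a,b); the conclusions are decidable, hence recomputable
  length-≡ : ∀ {P Q} → .(Shortest P) → .(Shortest Q) → length P ≡ length Q
  length-≡ sp sq = recompute (_ ℕₚ.≟ _) (shortest-length sp sq)

  shared-at : ∀ {P Q} → .(Shortest P) → .(Shortest Q) → ∀ k {u} →
    at P k ≡ just u → u ∈ Q → at Q k ≡ just u
  shared-at {P} {Q} sp sq k {u} atP u∈Q with at-∈ u∈Q
  ... | j , atQ = subst (λ m → at Q m ≡ just u) j≡k atQ
    where
    j≡k : j ≡ k
    j≡k = recompute (j ℕₚ.≟ k) (same-position j k sq sp atQ atP)

  outside⇒DifferAt : ∀ {P Q} → .(Shortest P) → .(Shortest Q) →
    ExactlyOneOutside G P Q → ∃ (DifferAt P Q)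
  outside⇒DifferAt {P} {Q} sp sq (x , x∈P , x∉Q , onlyX) with at-∈ x∈P
  ... | i , atPi = i , (λ eq → x∉Q (∈-at Q i (trans (sym eq) atPi))) , agree
    where
    agree : ∀ k → k ≢ i → at P k ≡ at Q k
    agree k k≢i with at P k in atPk
    ... | nothing = sym (at-nothing P Q k (length-≡ sp sq) atPk)
    ... | just u with u ∈? Q
    ...   | yes u∈Q = sym (shared-at sp sq k atPk u∈Q)
    ...   | no u∉Q with onlyX u (∈-at P k atPk) u∉Q
    ...     | refl = ⊥-elim (k≢i (recompute (k ℕₚ.≟ i) (at-unique P k i (proj₂ (proj₁ sp)) atPk atPi)))

  DifferAt⇒outside : ∀ {P Q i} → .(Shortest P) → .(Shortest Q) →
    DifferAt P Q i → ExactlyOneOutside G P Q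
  DifferAt⇒outside {P} {Q} {i} sp sq (differ , agree) with at P i in atPi
  ... | nothing = ⊥-elim (differ (sym (at-nothing P Q i (length-≡ sp sq) atPi)))
  ... | just u  = u , ∈-at P i atPi , u∉Q , onlyU
    where
    u∉Q : u ∉ Q
    u∉Q u∈Q = differ (sym (shared-at sp sq i atPi u∈Q))
    onlyU : ∀ z → z ∈ P → z ∉ Q → z ≡ u
    onlyU z z∈P z∉Q with at-∈ z∈P
    ... | k , atPk with k ℕₚ.≟ i
    ...   | yes refl = Maybeₚ.just-injective (trans (sym atPk) atPi)
    ...   | no k≢i   = ⊥-elim (z∉Q (∈-at Q k (trans (sym (agree k k≢i)) atPk)))

  Adjacent : List (Fin n) → List (Fin n) → Set
  Adjacent = DifferInOneVertex G

  adjacent⇒DifferAt : ∀ {P Q} → .(Shortest P) → .(Shortest Q) →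
    Adjacent P Q → ∃ (DifferAt P Q)
  adjacent⇒DifferAt sp sq (P∖Q , _) = outside⇒DifferAt sp sq P∖Q

  DifferAt⇒adjacent : ∀ {P Q i} → .(Shortest P) → .(Shortest Q) →
    DifferAt P Q i → Adjacent P Q
  DifferAt⇒adjacent {P} {Q} sp sq d =
    DifferAt⇒outside sp sq d , DifferAt⇒outside sq sp (DifferAt-sym {P = P} {Q} d)

  -- two distinct shortest paths adjacent to both ends of an edge XY both
  -- differ from X exactly where Y does, hence are adjacent to each other
  common-neighbours-adjacent : ∀ {X Y V Z} →
    .(Shortest X) → .(Shortest Y) → .(Shortest V) → .(Shortest Z) →
    Adjacent X Y → Adjacent V X → Adjacent V Y → Adjacent Z X → Adjacent Z Y →
    V ≢ Z → Adjacent V Z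
  common-neighbours-adjacent {X} {Y} {V} {Z} sx sy sv sz XY VX VY ZX ZY V≢Z
    with adjacent⇒DifferAt sx sy XY | adjacent⇒DifferAt sv sx VX | adjacent⇒DifferAt sv sy VY
       | adjacent⇒DifferAt sz sx ZX | adjacent⇒DifferAt sz sy ZY
  ... | _ , dXY | _ , dVX | _ , dVY | _ , dZX | _ , dZY =
    DifferAt⇒adjacent sv sz (DifferAt-merge {V = V} {X} {Z} V≢Z
      (subst (DifferAt V X) (DifferAt-common {X = X} {Y} {V} dXY dVX dVY) dVX)
      (subst (DifferAt Z X) (DifferAt-common {X = X} {Y} {Z} dXY dZX dZY) dZX))

-- Maximal cliques in graphs whose edge neighbourhoods are complete

module _ (H : Graph) where
  open Graph H

  EdgeNeighbourhoodsComplete : Set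
  EdgeNeighbourhoodsComplete = ∀ x y v z →
    Adj x y → Adj v x → Adj v y → Adj z x → Adj z y → v ≢ z → Adj v z

  -- a vertex outside a maximal clique K adjacent to two distinct vertices
  -- of K would be adjacent to all of K
  maximal-clique-attachment : DecidableEquality Vertex → EdgeNeighbourhoodsComplete →
    (K : Vertex → Set) → IsMaximalClique H K →
    ∀ v → ¬ K v → ∀ x y → K x → K y → Adj v x → Adj v y → x ≡ y
  maximal-clique-attachment _≟_ complete K (clique , maximal) v v∉K x y x∈K y∈K vx vy =
    decidable-stable (x ≟ y) λ x≢y → maximal v v∉K (adjacent-to-all x≢y)
    where
    adjacent-to-all : x ≢ y → ∀ z → K z → Adj v z
    adjacent-to-all x≢y z z∈K with z ≟ x | z ≟ y
    ... | yes refl | _        = vx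
    ... | no _     | yes refl = vy
    ... | no z≢x   | no z≢y   =
      complete x y v z (clique x y x∈K y∈K x≢y) vx vy
               (clique z x z∈K x∈K z≢x) (clique z y z∈K y∈K z≢y)
               (λ v≡z → v∉K (subst K (sym v≡z) z∈K))

module _ {H K : Graph} (iso : H ≅ K) where
  open _≅_ iso
  open Inverse bij using (to)

  ≅-decEq : DecidableEquality (Graph.Vertex K) → DecidableEquality (Graph.Vertex H)
  ≅-decEq = via-injection (↔⇒↣ bij)

  ≅-complete : EdgeNeighbourhoodsComplete K → EdgeNeighbourhoodsComplete H
  ≅-complete complete x y v z xy vx vy zx zy v≢z =
    reflects v z (complete (to x) (to y) (to v) (to z) (preserves x y xy) (preserves v x vx) (preserves v y vy)
                           (preserves z x zx) (preserves z y zy)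
                           (λ eq → v≢z (Injection.injective (↔⇒↣ bij) eq)))

module _ {n : ℕ} (G : SimpleGraph n) (a b : Fin n) where
  open ShortestPaths G a b using (common-neighbours-adjacent)

  S-decEq : DecidableEquality (Graph.Vertex (S G a b))
  S-decEq (mkSP P _) (mkSP Q _) =
    map′ (λ { refl → refl }) (cong ShortestPath.path) (Listₚ.≡-dec Finₚ._≟_ P Q)

  S-complete : EdgeNeighbourhoodsComplete (S G a b)
  S-complete (mkSP X sx) (mkSP Y sy) (mkSP V sv) (mkSP Z sz) XY VX VY ZX ZY V≢Z =
    common-neighbours-adjacent sx sy sv sz XY VX VY ZX ZY (λ { refl → V≢Z refl })

corollary9 : (H : Graph) → IsShortestPathGraph H →
    (K : Graph.Vertex H → Set) → IsMaximalClique H K →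
    ∀ v → ¬ K v → ∀ x y → K x → K y →
    Graph.Adj H v x → Graph.Adj H v y → x ≡ y
corollary9 H (n , G , a , b , _ , H≅S) =
  maximal-clique-attachment H (≅-decEq H≅S (S-decEq G a b)) (≅-complete H≅S (S-complete G a b))
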